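{- Let $S$ be a Kleene relation algebra satisfying the Tarski rule, let $x \in S$ be a mapping and let $y \in S$ be a point. For $a \in S$ put $\mathrm{fc}(a) = a^* \cdot (a^T)^*$. Let $u = \big(y \sqcap (x^T\cdot x^T\cdot y)^T\big) \sqcup (\overline{y} \sqcap x)$. Then $\mathrm{fc}(u) = \mathrm{fc}(x)$.
   Context: A Kleene relation algebra is a structure $(S,\sqcup,\sqcap,\cdot,\overline{\phantom{x}},{}^T,{}^*,\bot,\top,1)$ such that $(S,\sqcup,\sqcap,\overline{\phantom{x}},\bot,\top)$ is a Boolean algebra with order $x \sqsubseteq y \iff x \sqcup y = y$; $(S,\sqcup,\cdot,\bot,1)$ is an idempotent semiring ($\cdot$ associative with two-sided unit $1$, distributing over $\sqcup$, $\bot$ a two-sided zero of $\cdot$); transposition satisfies $(x\sqcup y)^T = x^T \sqcup y^T$, $(x^T)^T = x$, $(x\cdot y)^T = y^T\cdot x^T$ and $(x\cdot y)\sqcap z \sqsubseteq x\cdot(y\sqcap(x^T\cdot z))$; and the star satisfies $1\sqcup y\cdot y^* = y^* = 1 \sqcup y^*\cdot y$, $z\sqcup y\cdot x\sqsubseteq x \Rightarrow y^*\cdot z\sqsubseteq x$, $z \sqcup x\cdot y \sqsubseteq x \Rightarrow z\cdot y^*\sqsubseteq x$. The Tarski rule states $\top\cdot x\cdot\top = \top$ for every $x \neq \bot$. An element $x$ is univalent if $x^T x\sqsubseteq 1$, total if $1\sqsubseteq x x^T$, a mapping if univalent and total, injective if $x x^T\sqsubseteq 1$, surjective if $1\sqsubseteq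 x^T x$, a vector if $x\cdot\top = x$, and a point if it is an injective surjective vector. (In array terms, $u$ updates the parent array $x$ at node $y$ to the grandparent of $y$.) -}

module Defs where

open import Level using (Level; suc)
open import Relation.Binary.PropositionalEquality using (_≡_)
open import Relation.Nullary using (¬_)

record KleeneRelationAlgebra (a : Level) : Set (suc a) where
  infixr 6 _⊔_
  infixr 7 _⊓_
  infixr 8 _·_
  field
    S     : Set a
    _⊔_   : S → S → S
    _⊓_   : S → S → S
    _·_   : S → S → S
    ∁     : S → S
    _ᵀ    : S → S
    _⋆    : S → S
    ⊥′    : S
    ⊤′    : S
    𝟏     : S

  _⊑_ : S → S → Set a
  x ⊑ y = x ⊔ y ≡ y

  field
    ⊔-assoc : ∀ x y z → (x ⊔ y) ⊔ z ≡ x ⊔ (y ⊔ z)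
    ⊔-comm  : ∀ x y → x ⊔ y ≡ y ⊔ x
    ⊓-assoc : ∀ x y z → (x ⊓ y) ⊓ z ≡ x ⊓ (y ⊓ z)
    ⊓-comm  : ∀ x y → x ⊓ y ≡ y ⊓ x
    ⊔-absorbs-⊓ : ∀ x y → x ⊔ (x ⊓ y) ≡ x
    ⊓-absorbs-⊔ : ∀ x y → x ⊓ (x ⊔ y) ≡ x
    ⊓-distrib-⊔ : ∀ x y z → x ⊓ (y ⊔ z) ≡ (x ⊓ y) ⊔ (x ⊓ z)
    ⊔-bot   : ∀ x → x ⊔ ⊥′ ≡ x
    ⊓-top   : ∀ x → x ⊓ ⊤′ ≡ x
    ⊔-compl : ∀ x → x ⊔ ∁ x ≡ ⊤′
    ⊓-compl : ∀ x → x ⊓ ∁ x ≡ ⊥′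

    ·-assoc     : ∀ x y z → (x · y) · z ≡ x · (y · z)
    ·-identityˡ : ∀ x → 𝟏 · x ≡ x
    ·-identityʳ : ∀ x → x · 𝟏 ≡ x
    ·-distribˡ  : ∀ x y z → x · (y ⊔ z) ≡ (x · y) ⊔ (x · z)
    ·-distribʳ  : ∀ x y z → (x ⊔ y) · z ≡ (x · z) ⊔ (y · z)
    ·-zeroˡ     : ∀ x → ⊥′ · x ≡ ⊥′
    ·-zeroʳ     : ∀ x → x · ⊥′ ≡ ⊥′
    ⊔-idem      : ∀ x → x ⊔ x ≡ x

    ᵀ-⊔     : ∀ x y → (x ⊔ y) ᵀ ≡ (x ᵀ) ⊔ (y ᵀ)
    ᵀ-invol : ∀ x → (x ᵀ) ᵀ ≡ x
    ᵀ-·     : ∀ x y → (x · y) ᵀ ≡ (y ᵀ) · (x ᵀ)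
    dedekind : ∀ x y z → ((x · y) ⊓ z) ⊑ (x · (y ⊓ ((x ᵀ) · z)))

    star-unfoldˡ : ∀ y → 𝟏 ⊔ (y · (y ⋆)) ≡ y ⋆
    star-unfoldʳ : ∀ y → 𝟏 ⊔ ((y ⋆) · y) ≡ y ⋆
    star-inductˡ : ∀ x y z → (z ⊔ (y · x)) ⊑ x → ((y ⋆) · z) ⊑ x
    star-inductʳ : ∀ x y z → (z ⊔ (x · y)) ⊑ x → (z · (y ⋆)) ⊑ x

module KRA {a} (K : KleeneRelationAlgebra a) where
  open KleeneRelationAlgebra K public

  TarskiRule : Set a
  TarskiRule = ∀ x → ¬ (x ≡ ⊥′) → (⊤′ · x) · ⊤′ ≡ ⊤′

  univalent total mapping injective surjective vector point : S → Set a
  univalent x  = ((x ᵀ) · x) ⊑ 𝟏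
  total x      = 𝟏 ⊑ (x · (x ᵀ))
  mapping x    = univalent x × total x
    where open import Data.Product using (_×_)
  injective x  = (x · (x ᵀ)) ⊑ 𝟏
  surjective x = 𝟏 ⊑ ((x ᵀ) · x)
  vector x     = x · ⊤′ ≡ x
  point x      = injective x × (surjective x × vector x)
    where open import Data.Product using (_×_)

  fc : S → S
  fc z = (z ⋆) · ((z ᵀ) ⋆)

-- For a univalent c, fc c = c⋆ · (cᵀ)⋆ is an equivalence: univalence turns a backward
-- step followed by forward steps into forward steps followed by backward steps, so
-- fc c is transitive.  Hence fc c is the least equivalence containing c, and fc u ≡ fc x
-- follows from u being univalent, u ⊑ fc x and x ⊑ fc u.  The first two hold because u
-- agrees with x off the point y and with x · x on it.  For the third, the only edge of x
-- not in u is the one leaving y; if x(y) ≠ y, its target x(y) is linked to y through the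
-- common u-successor x(x(y)).

module Submission where

open import Defs
open import Level using (Level)
open import Data.Product using (_,_)
open import Relation.Binary.Bundles using (Poset)
open import Relation.Binary.Structures using (IsPartialOrder)
open import Relation.Binary.PropositionalEquality
  using (_≡_; refl; sym; trans; cong; cong₂; isEquivalence)
import Relation.Binary.Reasoning.PartialOrder as PosetReasoning

module Development {a : Level} (K : KleeneRelationAlgebra a) where
  open KRA K

  infix 4 _≤_
  _≤_ : S → S → Set a
  _≤_ = _⊑_

  ≤-refl : ∀ {x} → x ≤ x
  ≤-refl {x} = ⊔-idem x

  ≤-reflexive : ∀ {x y} → x ≡ y → x ≤ y
  ≤-reflexive refl = ≤-refl

  ≤-trans : ∀ {x y z} → x ≤ y → y ≤ z → x ≤ z
  ≤-trans {x} {y} {z} x≤y y≤z = begin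
      x ⊔ z        ≡⟨ cong (x ⊔_) y≤z ⟨
      x ⊔ (y ⊔ z)  ≡⟨ ⊔-assoc x y z ⟨
      (x ⊔ y) ⊔ z  ≡⟨ cong (_⊔ z) x≤y ⟩
      y ⊔ z        ≡⟨ y≤z ⟩
      z            ∎
    where open Relation.Binary.PropositionalEquality.≡-Reasoning

  ≤-antisym : ∀ {x y} → x ≤ y → y ≤ x → x ≡ y
  ≤-antisym {x} {y} x≤y y≤x = trans (sym y≤x) (trans (⊔-comm y x) x≤y)

  ≤-isPartialOrder : IsPartialOrder _≡_ _≤_
  ≤-isPartialOrder = record
    { isPreorder = record
      { isEquivalence = isEquivalence
      ; reflexive     = ≤-reflexive
      ; trans         = ≤-trans
      }
    ; antisym = ≤-antisym
    }

  ≤-poset : Poset a a a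
  ≤-poset = record { isPartialOrder = ≤-isPartialOrder }

  open PosetReasoning ≤-poset

  x≤x⊔y : ∀ {x y} → x ≤ x ⊔ y
  x≤x⊔y {x} {y} = trans (sym (⊔-assoc x x y)) (cong (_⊔ y) (⊔-idem x))

  y≤x⊔y : ∀ {x y} → y ≤ x ⊔ y
  y≤x⊔y {x} {y} = ≤-trans x≤x⊔y (≤-reflexive (⊔-comm y x))

  ⊔-least : ∀ {x y z} → x ≤ z → y ≤ z → x ⊔ y ≤ z
  ⊔-least {x} {y} {z} x≤z y≤z = trans (⊔-assoc x y z) (trans (cong (x ⊔_) y≤z) x≤z)

  ⊥′-least : ∀ {x} → ⊥′ ≤ x
  ⊥′-least {x} = trans (⊔-comm ⊥′ x) (⊔-bot x)

  ⊓≡⇒≤ : ∀ {x y} → x ⊓ y ≡ x → x ≤ y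
  ⊓≡⇒≤ {x} {y} x⊓y≡x = begin-equality
      x ⊔ y        ≡⟨ cong (_⊔ y) x⊓y≡x ⟨
      (x ⊓ y) ⊔ y  ≡⟨ ⊔-comm (x ⊓ y) y ⟩
      y ⊔ (x ⊓ y)  ≡⟨ cong (y ⊔_) (⊓-comm x y) ⟩
      y ⊔ (y ⊓ x)  ≡⟨ ⊔-absorbs-⊓ y x ⟩
      y            ∎

  ≤⇒⊓≡ : ∀ {x y} → x ≤ y → x ⊓ y ≡ x
  ≤⇒⊓≡ {x} {y} x≤y = trans (cong (x ⊓_) (sym x≤y)) (⊓-absorbs-⊔ x y)

  x⊓y≤x : ∀ {x y} → x ⊓ y ≤ x
  x⊓y≤x {x} {y} = trans (⊔-comm (x ⊓ y) x) (⊔-absorbs-⊓ x y)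

  x⊓y≤y : ∀ {x y} → x ⊓ y ≤ y
  x⊓y≤y {x} {y} = ≤-trans (≤-reflexive (⊓-comm x y)) x⊓y≤x

  ⊓-greatest : ∀ {x y z} → z ≤ x → z ≤ y → z ≤ x ⊓ y
  ⊓-greatest {x} {y} {z} z≤x z≤y =
    ⊓≡⇒≤ (trans (sym (⊓-assoc z x y)) (trans (cong (_⊓ y) (≤⇒⊓≡ z≤x)) (≤⇒⊓≡ z≤y)))

  ⊓-mono : ∀ {x y z w} → x ≤ y → z ≤ w → x ⊓ z ≤ y ⊓ w
  ⊓-mono x≤y z≤w = ⊓-greatest (≤-trans x⊓y≤x x≤y) (≤-trans x⊓y≤y z≤w)

  ⊤′-greatest : ∀ {x} → x ≤ ⊤′
  ⊤′-greatest {x} = ⊓≡⇒≤ (⊓-top x)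

  x≡x⊓y⊔x⊓∁y : ∀ x y → x ≡ x ⊓ y ⊔ x ⊓ ∁ y
  x≡x⊓y⊔x⊓∁y x y = begin-equality
      x                     ≡⟨ ⊓-top x ⟨
      x ⊓ ⊤′                ≡⟨ cong (x ⊓_) (⊔-compl y) ⟨
      x ⊓ (y ⊔ ∁ y)         ≡⟨ ⊓-distrib-⊔ x y (∁ y) ⟩
      x ⊓ y ⊔ x ⊓ ∁ y       ∎

  ·-monoʳ : ∀ {x y z} → x ≤ y → z · x ≤ z · y
  ·-monoʳ {x} {y} {z} x≤y = trans (sym (·-distribˡ z x y)) (cong (z ·_) x≤y)

  ·-monoˡ : ∀ {x y z} → x ≤ y → x · z ≤ y · z
  ·-monoˡ {x} {y} {z} x≤y = trans (sym (·-distribʳ x y z)) (cong (_· z) x≤y)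

  ·-mono : ∀ {x y z w} → x ≤ y → z ≤ w → x · z ≤ y · w
  ·-mono x≤y z≤w = ≤-trans (·-monoˡ x≤y) (·-monoʳ z≤w)

  ᵀ-mono : ∀ {x y} → x ≤ y → x ᵀ ≤ y ᵀ
  ᵀ-mono {x} {y} x≤y = trans (sym (ᵀ-⊔ x y)) (cong _ᵀ x≤y)

  ᵀ-⊓ : ∀ {x y} → (x ⊓ y) ᵀ ≤ x ᵀ ⊓ y ᵀ
  ᵀ-⊓ = ⊓-greatest (ᵀ-mono x⊓y≤x) (ᵀ-mono x⊓y≤y)

  ᵀ-⊥′ : ⊥′ ᵀ ≡ ⊥′
  ᵀ-⊥′ = ≤-antisym (≤-trans (ᵀ-mono (⊥′-least {⊥′ ᵀ})) (≤-reflexive (ᵀ-invol ⊥′))) ⊥′-least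

  ᵀ-𝟏 : 𝟏 ᵀ ≡ 𝟏
  ᵀ-𝟏 = begin-equality
      𝟏 ᵀ              ≡⟨ ·-identityʳ (𝟏 ᵀ) ⟨
      𝟏 ᵀ · 𝟏          ≡⟨ cong (𝟏 ᵀ ·_) (ᵀ-invol 𝟏) ⟨
      𝟏 ᵀ · 𝟏 ᵀ ᵀ      ≡⟨ ᵀ-· (𝟏 ᵀ) 𝟏 ⟨
      (𝟏 ᵀ · 𝟏) ᵀ      ≡⟨ cong _ᵀ (·-identityʳ (𝟏 ᵀ)) ⟩
      𝟏 ᵀ ᵀ            ≡⟨ ᵀ-invol 𝟏 ⟩
      𝟏                ∎

  dedekind′ : ∀ x y z → (x · y) ⊓ z ≤ (x ⊓ z · y ᵀ) · y
  dedekind′ x y z = begin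
      (x · y) ⊓ z                          ≡⟨ ᵀ-invol _ ⟨
      ((x · y) ⊓ z) ᵀ ᵀ                    ≤⟨ ᵀ-mono ᵀ-⊓ ⟩
      ((x · y) ᵀ ⊓ z ᵀ) ᵀ                  ≡⟨ cong (λ w → (w ⊓ z ᵀ) ᵀ) (ᵀ-· x y) ⟩
      (y ᵀ · x ᵀ ⊓ z ᵀ) ᵀ                  ≤⟨ ᵀ-mono (dedekind (y ᵀ) (x ᵀ) (z ᵀ)) ⟩
      (y ᵀ · (x ᵀ ⊓ y ᵀ ᵀ · z ᵀ)) ᵀ        ≡⟨ ᵀ-· _ _ ⟩
      (x ᵀ ⊓ y ᵀ ᵀ · z ᵀ) ᵀ · y ᵀ ᵀ        ≤⟨ ·-monoˡ ᵀ-⊓ ⟩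
      (x ᵀ ᵀ ⊓ (y ᵀ ᵀ · z ᵀ) ᵀ) · y ᵀ ᵀ   ≡⟨ cong₂ (λ p q → (p ⊓ q) · y ᵀ ᵀ) (ᵀ-invol x) (ᵀ-· _ _) ⟩
      (x ⊓ z ᵀ ᵀ · y ᵀ ᵀ ᵀ) · y ᵀ ᵀ        ≡⟨ cong₂ (λ p q → (x ⊓ p · q ᵀ) · q) (ᵀ-invol z) (ᵀ-invol y) ⟩
      (x ⊓ z · y ᵀ) · y                    ∎

  ≤𝟏⇒≤ᵀ : ∀ {t} → t ≤ 𝟏 → t ≤ t ᵀ
  ≤𝟏⇒≤ᵀ {t} t≤𝟏 = begin
      t                    ≡⟨ trans (cong (_⊓ 𝟏) (·-identityʳ t)) (≤⇒⊓≡ t≤𝟏) ⟨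
      (t · 𝟏) ⊓ 𝟏          ≤⟨ dedekind t 𝟏 𝟏 ⟩
      t · (𝟏 ⊓ t ᵀ · 𝟏)    ≤⟨ ·-monoʳ x⊓y≤y ⟩
      t · t ᵀ · 𝟏          ≡⟨ cong (t ·_) (·-identityʳ (t ᵀ)) ⟩
      t · t ᵀ              ≤⟨ ·-monoˡ t≤𝟏 ⟩
      𝟏 · t ᵀ              ≡⟨ ·-identityˡ _ ⟩
      t ᵀ                  ∎

  vector-⊓≤test· : ∀ {v} w → vector v → v ⊓ w ≤ (𝟏 ⊓ v) · w
  vector-⊓≤test· {v} w v-vector = begin
      v ⊓ w            ≡⟨ trans (⊓-comm v w) (cong (_⊓ v) (sym (·-identityˡ w))) ⟩
      (𝟏 · w) ⊓ v      ≤⟨ dedekind′ 𝟏 w v ⟩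
      (𝟏 ⊓ v · w ᵀ) · w ≤⟨ ·-monoˡ (⊓-mono ≤-refl (≤-trans (·-monoʳ ⊤′-greatest) (≤-reflexive v-vector))) ⟩
      (𝟏 ⊓ v) · w      ∎

  vector-injective-⊓ᵀ·≤ : ∀ {v} w → injective v → vector v → v ⊓ v ᵀ · w ≤ w
  vector-injective-⊓ᵀ·≤ {v} w v-injective v-vector = begin
      v ⊓ v ᵀ · w          ≤⟨ vector-⊓≤test· _ v-vector ⟩
      (𝟏 ⊓ v) · v ᵀ · w    ≤⟨ ·-monoˡ x⊓y≤y ⟩
      v · v ᵀ · w          ≡⟨ ·-assoc _ _ _ ⟨
      (v · v ᵀ) · w        ≤⟨ ·-monoˡ v-injective ⟩
      𝟏 · w                ≡⟨ ·-identityˡ w ⟩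
      w                    ∎

  vector-separatesᵀ· : ∀ {v p q} → vector v → p ≤ v → q ≤ ∁ v → p ᵀ · q ≤ ⊥′
  vector-separatesᵀ· {v} {p} {q} v-vector p≤v q≤∁v = begin
      p ᵀ · q                    ≡⟨ ⊓-top _ ⟨
      (p ᵀ · q) ⊓ ⊤′             ≤⟨ dedekind (p ᵀ) q ⊤′ ⟩
      p ᵀ · (q ⊓ p ᵀ ᵀ · ⊤′)     ≡⟨ cong (λ r → p ᵀ · (q ⊓ r · ⊤′)) (ᵀ-invol p) ⟩
      p ᵀ · (q ⊓ p · ⊤′)         ≤⟨ ·-monoʳ (⊓-mono q≤∁v (≤-trans (·-monoˡ p≤v) (≤-reflexive v-vector))) ⟩
      p ᵀ · (∁ v ⊓ v)            ≡⟨ cong (p ᵀ ·_) (trans (⊓-comm (∁ v) v) (⊓-compl v)) ⟩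
      p ᵀ · ⊥′                   ≡⟨ ·-zeroʳ _ ⟩
      ⊥′                         ∎

  univalent-anti : ∀ {p q} → p ≤ q → univalent q → univalent p
  univalent-anti p≤q q-univalent = ≤-trans (·-mono (ᵀ-mono p≤q) p≤q) q-univalent

  univalent-· : ∀ {p q} → univalent p → univalent q → univalent (p · q)
  univalent-· {p} {q} p-univalent q-univalent = begin
      (p · q) ᵀ · p · q      ≡⟨ cong (_· p · q) (ᵀ-· p q) ⟩
      (q ᵀ · p ᵀ) · p · q    ≡⟨ trans (·-assoc _ _ _) (cong (q ᵀ ·_) (sym (·-assoc _ _ _))) ⟩
      q ᵀ · (p ᵀ · p) · q    ≤⟨ ·-monoʳ (·-monoˡ p-univalent) ⟩
      q ᵀ · 𝟏 · q            ≡⟨ cong (q ᵀ ·_) (·-identityˡ q) ⟩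
      q ᵀ · q                ≤⟨ q-univalent ⟩
      𝟏                      ∎

  univalent-⊔ : ∀ {v p q} → vector v → p ≤ v → q ≤ ∁ v →
                univalent p → univalent q → univalent (p ⊔ q)
  univalent-⊔ {v} {p} {q} v-vector p≤v q≤∁v p-univalent q-univalent = begin
      (p ⊔ q) ᵀ · (p ⊔ q)                                  ≡⟨ cong (_· (p ⊔ q)) (ᵀ-⊔ p q) ⟩
      (p ᵀ ⊔ q ᵀ) · (p ⊔ q)                                ≡⟨ expand ⟩
      (p ᵀ · p ⊔ p ᵀ · q) ⊔ (q ᵀ · p ⊔ q ᵀ · q)            ≤⟨ ⊔-least (⊔-least p-univalent (≤-trans pᵀq≤⊥ ⊥′-least))
                                                                     (⊔-least (≤-trans qᵀp≤⊥ ⊥′-least) q-univalent) ⟩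
      𝟏                                                    ∎
    where
    expand : (p ᵀ ⊔ q ᵀ) · (p ⊔ q) ≡ (p ᵀ · p ⊔ p ᵀ · q) ⊔ (q ᵀ · p ⊔ q ᵀ · q)
    expand = trans (·-distribʳ _ _ _) (cong₂ _⊔_ (·-distribˡ _ _ _) (·-distribˡ _ _ _))
    pᵀq≤⊥ : p ᵀ · q ≤ ⊥′
    pᵀq≤⊥ = vector-separatesᵀ· v-vector p≤v q≤∁v
    qᵀp≤⊥ : q ᵀ · p ≤ ⊥′
    qᵀp≤⊥ = begin
      q ᵀ · p              ≡⟨ cong (q ᵀ ·_) (ᵀ-invol p) ⟨
      q ᵀ · p ᵀ ᵀ          ≡⟨ ᵀ-· (p ᵀ) q ⟨
      (p ᵀ · q) ᵀ          ≤⟨ ᵀ-mono pᵀq≤⊥ ⟩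
      ⊥′ ᵀ                 ≡⟨ ᵀ-⊥′ ⟩
      ⊥′                   ∎

  𝟏≤⋆ : ∀ {c} → 𝟏 ≤ c ⋆
  𝟏≤⋆ {c} = ≤-trans x≤x⊔y (≤-reflexive (star-unfoldˡ c))

  ·⋆≤⋆ : ∀ {c} → c · c ⋆ ≤ c ⋆
  ·⋆≤⋆ {c} = ≤-trans y≤x⊔y (≤-reflexive (star-unfoldˡ c))

  ⋆·≤⋆ : ∀ {c} → c ⋆ · c ≤ c ⋆
  ⋆·≤⋆ {c} = ≤-trans y≤x⊔y (≤-reflexive (star-unfoldʳ c))

  ≤⋆ : ∀ {c} → c ≤ c ⋆
  ≤⋆ {c} = ≤-trans (≤-reflexive (sym (·-identityʳ c))) (≤-trans (·-monoʳ 𝟏≤⋆) ·⋆≤⋆)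

  ⋆-least : ∀ {c e} → 𝟏 ≤ e → c · e ≤ e → c ⋆ ≤ e
  ⋆-least {c} {e} 𝟏≤e ce≤e =
    ≤-trans (≤-reflexive (sym (·-identityʳ (c ⋆)))) (star-inductˡ e c 𝟏 (⊔-least 𝟏≤e ce≤e))

  ⋆·⋆≤⋆ : ∀ {c} → c ⋆ · c ⋆ ≤ c ⋆
  ⋆·⋆≤⋆ {c} = star-inductˡ (c ⋆) c (c ⋆) (⊔-least ≤-refl ·⋆≤⋆)

  ⋆ᵀ≤ᵀ⋆ : ∀ {c} → (c ⋆) ᵀ ≤ c ᵀ ⋆
  ⋆ᵀ≤ᵀ⋆ {c} = ≤-trans (ᵀ-mono c⋆≤ᵀ⋆ᵀ) (≤-reflexive (ᵀ-invol _))
    where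
    cᵀ⋆ᵀ-closed : c · (c ᵀ ⋆) ᵀ ≤ (c ᵀ ⋆) ᵀ
    cᵀ⋆ᵀ-closed = begin
      c · (c ᵀ ⋆) ᵀ          ≡⟨ cong (_· (c ᵀ ⋆) ᵀ) (ᵀ-invol c) ⟨
      c ᵀ ᵀ · (c ᵀ ⋆) ᵀ      ≡⟨ ᵀ-· _ _ ⟨
      (c ᵀ ⋆ · c ᵀ) ᵀ        ≤⟨ ᵀ-mono ⋆·≤⋆ ⟩
      (c ᵀ ⋆) ᵀ              ∎
    c⋆≤ᵀ⋆ᵀ : c ⋆ ≤ (c ᵀ ⋆) ᵀ
    c⋆≤ᵀ⋆ᵀ = ⋆-least (≤-trans (≤-reflexive (sym ᵀ-𝟏)) (ᵀ-mono 𝟏≤⋆)) cᵀ⋆ᵀ-closed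

  record Equivalence (e : S) : Set a where
    field
      reflexive  : 𝟏 ≤ e
      symmetric  : e ᵀ ≤ e
      transitive : e · e ≤ e

  fc-least : ∀ {c e} → Equivalence e → c ≤ e → fc c ≤ e
  fc-least {c} {e} e-equiv c≤e = ≤-trans (·-mono (closed c≤e) (closed cᵀ≤e)) transitive
    where
    open Equivalence e-equiv
    closed : ∀ {b} → b ≤ e → b ⋆ ≤ e
    closed b≤e = ⋆-least reflexive (≤-trans (·-monoˡ b≤e) transitive)
    cᵀ≤e : c ᵀ ≤ e
    cᵀ≤e = ≤-trans (ᵀ-mono c≤e) symmetric

  𝟏≤fc : ∀ {c} → 𝟏 ≤ fc c
  𝟏≤fc = ≤-trans (≤-reflexive (sym (·-identityʳ 𝟏))) (·-mono 𝟏≤⋆ 𝟏≤⋆)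

  ≤fc : ∀ {c} → c ≤ fc c
  ≤fc {c} = ≤-trans (≤-reflexive (sym (·-identityʳ c))) (·-mono ≤⋆ 𝟏≤⋆)

  ·ᵀ≤fc : ∀ {c} → c · c ᵀ ≤ fc c
  ·ᵀ≤fc = ·-mono ≤⋆ ≤⋆

  fcᵀ≤fc : ∀ {c} → fc c ᵀ ≤ fc c
  fcᵀ≤fc {c} = begin
      (c ⋆ · c ᵀ ⋆) ᵀ        ≡⟨ ᵀ-· _ _ ⟩
      (c ᵀ ⋆) ᵀ · (c ⋆) ᵀ    ≤⟨ ·-mono ⋆ᵀ≤ᵀ⋆ ⋆ᵀ≤ᵀ⋆ ⟩
      c ᵀ ᵀ ⋆ · c ᵀ ⋆        ≡⟨ cong (λ d → d ⋆ · c ᵀ ⋆) (ᵀ-invol c) ⟩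
      fc c                   ∎

  univalent⇒ᵀ·⋆≤fc : ∀ {c} → univalent c → c ᵀ · c ⋆ ≤ fc c
  univalent⇒ᵀ·⋆≤fc {c} c-univalent = begin
      c ᵀ · c ⋆                    ≡⟨ cong (c ᵀ ·_) (star-unfoldˡ c) ⟨
      c ᵀ · (𝟏 ⊔ c · c ⋆)          ≡⟨ ·-distribˡ _ _ _ ⟩
      c ᵀ · 𝟏 ⊔ c ᵀ · c · c ⋆      ≤⟨ ⊔-least back forth ⟩
      fc c                         ∎
    where
    back : c ᵀ · 𝟏 ≤ fc c
    back = ≤-trans (≤-reflexive (trans (·-identityʳ _) (sym (·-identityˡ _)))) (·-mono 𝟏≤⋆ ≤⋆)
    forth : c ᵀ · c · c ⋆ ≤ fc c
    forth = begin
      c ᵀ · c · c ⋆        ≡⟨ ·-assoc _ _ _ ⟨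
      (c ᵀ · c) · c ⋆      ≤⟨ ·-monoˡ c-univalent ⟩
      𝟏 · c ⋆              ≡⟨ trans (·-identityˡ _) (sym (·-identityʳ _)) ⟩
      c ⋆ · 𝟏              ≤⟨ ·-monoʳ 𝟏≤⋆ ⟩
      fc c                 ∎

  univalent⇒ᵀ⋆·⋆≤fc : ∀ {c} → univalent c → c ᵀ ⋆ · c ⋆ ≤ fc c
  univalent⇒ᵀ⋆·⋆≤fc {c} c-univalent =
    star-inductˡ (fc c) (c ᵀ) (c ⋆) (⊔-least (≤-trans (≤-reflexive (sym (·-identityʳ _))) (·-monoʳ 𝟏≤⋆)) cᵀfc≤fc)
    where
    cᵀfc≤fc : c ᵀ · fc c ≤ fc c
    cᵀfc≤fc = begin
      c ᵀ · c ⋆ · c ᵀ ⋆              ≡⟨ ·-assoc _ _ _ ⟨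
      (c ᵀ · c ⋆) · c ᵀ ⋆            ≤⟨ ·-monoˡ (univalent⇒ᵀ·⋆≤fc c-univalent) ⟩
      (c ⋆ · c ᵀ ⋆) · c ᵀ ⋆          ≡⟨ ·-assoc _ _ _ ⟩
      c ⋆ · c ᵀ ⋆ · c ᵀ ⋆            ≤⟨ ·-monoʳ ⋆·⋆≤⋆ ⟩
      fc c                           ∎

  univalent⇒fc-transitive : ∀ {c} → univalent c → fc c · fc c ≤ fc c
  univalent⇒fc-transitive {c} c-univalent = begin
      (c ⋆ · c ᵀ ⋆) · c ⋆ · c ᵀ ⋆        ≡⟨ trans (·-assoc _ _ _) (cong (c ⋆ ·_) (sym (·-assoc _ _ _))) ⟩
      c ⋆ · (c ᵀ ⋆ · c ⋆) · c ᵀ ⋆        ≤⟨ ·-monoʳ (·-monoˡ (univalent⇒ᵀ⋆·⋆≤fc c-univalent)) ⟩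
      c ⋆ · (c ⋆ · c ᵀ ⋆) · c ᵀ ⋆        ≡⟨ cong (c ⋆ ·_) (·-assoc _ _ _) ⟩
      c ⋆ · c ⋆ · c ᵀ ⋆ · c ᵀ ⋆          ≤⟨ ·-monoʳ (·-monoʳ ⋆·⋆≤⋆) ⟩
      c ⋆ · c ⋆ · c ᵀ ⋆                  ≡⟨ ·-assoc _ _ _ ⟨
      (c ⋆ · c ⋆) · c ᵀ ⋆                ≤⟨ ·-monoˡ ⋆·⋆≤⋆ ⟩
      fc c                               ∎

  univalent⇒fc-equivalence : ∀ {c} → univalent c → Equivalence (fc c)
  univalent⇒fc-equivalence c-univalent = record
    { reflexive  = 𝟏≤fc
    ; symmetric  = fcᵀ≤fc
    ; transitive = univalent⇒fc-transitive c-univalent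
    }

  univalent⇒fc-mono : ∀ {b c} → univalent c → b ≤ fc c → fc b ≤ fc c
  univalent⇒fc-mono c-univalent = fc-least (univalent⇒fc-equivalence c-univalent)

  module Update (x y : S) (x-univalent : univalent x) (x-total : total x)
                (y-injective : injective y) (y-vector : vector y) where

    new old u : S
    new = y ⊓ (x ᵀ · x ᵀ · y) ᵀ
    old = ∁ y ⊓ x
    u   = new ⊔ old

    ᵀ-xᵀ·xᵀ·y : (x ᵀ · x ᵀ · y) ᵀ ≡ y ᵀ · x · x
    ᵀ-xᵀ·xᵀ·y = begin-equality
      (x ᵀ · x ᵀ · y) ᵀ         ≡⟨ ᵀ-· _ _ ⟩
      (x ᵀ · y) ᵀ · x ᵀ ᵀ       ≡⟨ cong₂ _·_ (ᵀ-· _ _) (ᵀ-invol x) ⟩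
      (y ᵀ · x ᵀ ᵀ) · x         ≡⟨ cong (λ r → (y ᵀ · r) · x) (ᵀ-invol x) ⟩
      (y ᵀ · x) · x             ≡⟨ ·-assoc _ _ _ ⟩
      y ᵀ · x · x               ∎

    new≤x·x : new ≤ x · x
    new≤x·x = begin
      y ⊓ (x ᵀ · x ᵀ · y) ᵀ     ≡⟨ cong (y ⊓_) ᵀ-xᵀ·xᵀ·y ⟩
      y ⊓ y ᵀ · x · x           ≤⟨ vector-injective-⊓ᵀ·≤ (x · x) y-injective y-vector ⟩
      x · x                     ∎

    u-univalent : univalent u
    u-univalent = univalent-⊔ y-vector x⊓y≤x x⊓y≤x
      (univalent-anti new≤x·x (univalent-· x-univalent x-univalent))
      (univalent-anti x⊓y≤y x-univalent)

    u≤fc-x : u ≤ fc x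
    u≤fc-x = ⊔-least new≤fc-x (≤-trans x⊓y≤y ≤fc)
      where
      new≤fc-x : new ≤ fc x
      new≤fc-x = ≤-trans new≤x·x (≤-trans (·-mono ≤fc ≤fc) (univalent⇒fc-transitive x-univalent))

    test·x·x≤new : (𝟏 ⊓ y) · x · x ≤ new
    test·x·x≤new = ⊓-greatest
      (≤-trans (·-mono x⊓y≤y ⊤′-greatest) (≤-reflexive y-vector))
      (≤-trans (·-monoˡ (≤-trans (≤𝟏⇒≤ᵀ x⊓y≤x) (ᵀ-mono x⊓y≤y))) (≤-reflexive (sym ᵀ-xᵀ·xᵀ·y)))

    x⊓y≤new·xᵀ : x ⊓ y ≤ new · x ᵀ
    x⊓y≤new·xᵀ = begin
      x ⊓ y                       ≡⟨ ⊓-comm x y ⟩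
      y ⊓ x                       ≤⟨ vector-⊓≤test· x y-vector ⟩
      (𝟏 ⊓ y) · x                 ≡⟨ cong ((𝟏 ⊓ y) ·_) (·-identityʳ x) ⟨
      (𝟏 ⊓ y) · x · 𝟏             ≤⟨ ·-monoʳ (·-monoʳ x-total) ⟩
      (𝟏 ⊓ y) · x · x · x ᵀ       ≡⟨ trans (cong ((𝟏 ⊓ y) ·_) (sym (·-assoc _ _ _))) (sym (·-assoc _ _ _)) ⟩
      ((𝟏 ⊓ y) · x · x) · x ᵀ     ≤⟨ ·-monoˡ test·x·x≤new ⟩
      new · x ᵀ                   ∎

    new·xᵀ≤fc-u : new · x ᵀ ≤ fc u
    new·xᵀ≤fc-u = begin
      new · x ᵀ                                  ≡⟨ cong (λ r → new · r ᵀ) (x≡x⊓y⊔x⊓∁y x y) ⟩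
      new · (x ⊓ y ⊔ x ⊓ ∁ y) ᵀ                  ≡⟨ trans (cong (new ·_) (ᵀ-⊔ _ _)) (·-distribˡ _ _ _) ⟩
      new · (x ⊓ y) ᵀ ⊔ new · (x ⊓ ∁ y) ᵀ        ≤⟨ ⊔-least at-y off-y ⟩
      fc u                                       ∎
      where
      at-y : new · (x ⊓ y) ᵀ ≤ fc u
      at-y = ≤-trans (·-mono x⊓y≤x (ᵀ-mono x⊓y≤y)) (≤-trans y-injective 𝟏≤fc)
      off-y : new · (x ⊓ ∁ y) ᵀ ≤ fc u
      off-y = ≤-trans (·-mono x≤x⊔y (ᵀ-mono (≤-trans (≤-reflexive (⊓-comm x (∁ y))) y≤x⊔y))) ·ᵀ≤fc

    x≤fc-u : x ≤ fc u
    x≤fc-u = begin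
      x                  ≡⟨ x≡x⊓y⊔x⊓∁y x y ⟩
      x ⊓ y ⊔ x ⊓ ∁ y    ≤⟨ ⊔-least (≤-trans x⊓y≤new·xᵀ new·xᵀ≤fc-u) old≤fc-u ⟩
      fc u               ∎
      where
      old≤fc-u : x ⊓ ∁ y ≤ fc u
      old≤fc-u = ≤-trans (≤-reflexive (⊓-comm x (∁ y))) (≤-trans y≤x⊔y ≤fc)

    fc-u≡fc-x : fc u ≡ fc x
    fc-u≡fc-x = ≤-antisym (univalent⇒fc-mono x-univalent u≤fc-x)
                          (univalent⇒fc-mono u-univalent x≤fc-u)

theorem11p6 : ∀ {a : Level} (K : KleeneRelationAlgebra a) →
    let open KRA K in
    TarskiRule → ∀ (x y : S) → mapping x → point y →
    fc ((y ⊓ (((x ᵀ) · ((x ᵀ) · y)) ᵀ)) ⊔ ((∁ y) ⊓ x)) ≡ fc x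
theorem11p6 K _ x y (x-univalent , x-total) (y-injective , _ , y-vector) =
  Update.fc-u≡fc-x x y x-univalent x-total y-injective y-vector
  where open Development K
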